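{- Let $A$ be an integer matrix indexed by the non-negative integers (each row and column having finitely many nonzero entries, so that $A^2$ is defined), and let $M$ be a valuation matrix such that $\nu_2(A-I)\geq M$. Then \[\nu_2(A^2-I)\geq \min\{M+\mathbf{1},\,M*M\}.\]
   Context: A valuation matrix is a matrix (indexed by non-negative integers) with entries in $\mathbb{Z}_{\ge0}\cup\{\infty\}$. For an integer matrix $A$, $\nu_2(A)$ is the valuation matrix with entries $\nu_2(A(r,s))$, where $\nu_2$ is the $2$-adic valuation and $\nu_2(0)=\infty$. For valuation matrices, $N\geq M$ means $N(r,s)\geq M(r,s)$ for all $r,s$; $(M*N)(r,s)=\min\{M(r,t)+N(t,s):t\geq0\}$; $M+\mathbf{1}$ is $M$ with every entry increased by $1$; and $\min$ of two valuation matrices is taken entrywise. $I$ is the identity matrix. -}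

module Defs where

open import Data.Nat as ℕ using (ℕ; zero; suc; _≟_)
open import Data.Nat.DivMod using (_%_; _/_)
open import Data.Integer as ℤ using (ℤ; ∣_∣; +_)
open import Data.Product using (Σ; ∃; _×_)
open import Relation.Nullary using (yes; no)
open import Relation.Binary.PropositionalEquality using (_≡_)

data ℕ∞ : Set where
  fin : ℕ → ℕ∞
  ∞   : ℕ∞

infix 4 _≤∞_
data _≤∞_ : ℕ∞ → ℕ∞ → Set where
  fin≤fin : ∀ {m n} → m ℕ.≤ n → fin m ≤∞ fin n
  _≤∞∞    : ∀ x → x ≤∞ ∞

infixl 6 _+∞_
_+∞_ : ℕ∞ → ℕ∞ → ℕ∞
fin m +∞ fin n = fin (m ℕ.+ n)
fin m +∞ ∞     = ∞
∞     +∞ _     = ∞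

min∞ : ℕ∞ → ℕ∞ → ℕ∞
min∞ (fin m) (fin n) = fin (ℕ._⊓_ m n)
min∞ (fin m) ∞       = fin m
min∞ ∞       y       = y

val2 : ℕ → (fuel : ℕ) → ℕ
val2 n zero = zero
val2 n (suc f) with n % 2 ≟ 0
... | yes _ = suc (val2 (n / 2) f)
... | no  _ = zero

-- ν₂ : ℤ → ℕ ∪ {∞}, ν₂ 0 = ∞ (fuel ∣x∣ suffices for x ≠ 0)
ν₂ : ℤ → ℕ∞
ν₂ x with ∣ x ∣
... | zero  = ∞
... | suc n = fin (val2 (suc n) (suc n))

Matrix : Set → Set
Matrix X = ℕ → ℕ → X

ValMatrix : Set
ValMatrix = Matrix ℕ∞

record IntMatrix : Set where
  field
    entry    : Matrix ℤ
    rowBound : ℕ → ℕ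
    rowFin   : ∀ r t → rowBound r ℕ.≤ t → entry r t ≡ + 0
    colBound : ℕ → ℕ
    colFin   : ∀ s t → colBound s ℕ.≤ t → entry t s ≡ + 0
open IntMatrix public

Σ< : ℕ → (ℕ → ℤ) → ℤ
Σ< zero    f = + 0
Σ< (suc n) f = Σ< n f ℤ.+ f n

I : Matrix ℤ
I r s with r ≟ s
... | yes _ = + 1
... | no  _ = + 0

-- A² (r,s) = Σ_t A(r,t) A(t,s); only t < rowBound r contribute
sq : IntMatrix → Matrix ℤ
sq A r s = Σ< (rowBound A r) (λ t → entry A r t ℤ.* entry A t s)

_-M_ : Matrix ℤ → Matrix ℤ → Matrix ℤ
(X -M Y) r s = X r s ℤ.- Y r s

νM : Matrix ℤ → ValMatrix
νM X r s = ν₂ (X r s)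

_≥M_ : ValMatrix → ValMatrix → Set
N ≥M M = ∀ r s → M r s ≤∞ N r s

_+𝟏 : ValMatrix → ValMatrix
(M +𝟏) r s = M r s +∞ fin 1

minM : ValMatrix → ValMatrix → ValMatrix
minM M N r s = min∞ (M r s) (N r s)

-- (M * N)(r,s) = min_t { M(r,t) + N(t,s) }, as a relation
-- (the minimum over ℕ∞ always exists classically, but is not computable)
IsMinPlus : ValMatrix → ValMatrix → ℕ → ℕ → ℕ∞ → Set
IsMinPlus M N r s m =
  (∃ λ t → M r t +∞ N t s ≡ m) × (∀ t → m ≤∞ M r t +∞ N t s)

module Submission where

-- Writing A = I + B, the entry (r,s) of A² − I is Σₜ B(r,t) B(t,s) + 2 B(r,s).
-- Each product B(r,t) B(t,s) has valuation at least M(r,t) + M(t,s) ≥ (M*M)(r,s),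
-- the term 2 B(r,s) has valuation at least M(r,s) + 1, and ν₂ of a sum is at
-- least the minimum of the valuations of its terms.

open import Defs
open import Data.Nat as ℕ using (ℕ; zero; suc; _≟_; _^_; _≤_; _<_; z≤n; s≤s)
import Data.Nat.Properties as ℕₚ
open import Data.Nat.DivMod using (_%_; _/_; m≡m%n+[m/n]*n)
open import Data.Nat.Divisibility as ℕ∣ using (_∣_)
open import Data.Integer as ℤ using (ℤ; ∣_∣; +_)
import Data.Integer.Properties as ℤₚ
import Data.Integer.Divisibility.Signed as ℤ∣
open import Data.Integer.Tactic.RingSolver using (solve-∀)
open import Data.Product using (∃; _,_)
open import Data.Sum using (inj₁; inj₂)
open import Data.Empty using (⊥-elim)
open import Relation.Nullary using (yes; no)
open import Relation.Binary.PropositionalEquality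

≤∞-refl : ∀ {x} → x ≤∞ x
≤∞-refl {fin m} = fin≤fin ℕₚ.≤-refl
≤∞-refl {∞}     = ∞ ≤∞∞

≤∞-trans : ∀ {x y z} → x ≤∞ y → y ≤∞ z → x ≤∞ z
≤∞-trans (fin≤fin p) (fin≤fin q) = fin≤fin (ℕₚ.≤-trans p q)
≤∞-trans p           (_ ≤∞∞)     = _ ≤∞∞

min∞-≤ˡ : ∀ x y → min∞ x y ≤∞ x
min∞-≤ˡ (fin m) (fin n) = fin≤fin (ℕₚ.m⊓n≤m m n)
min∞-≤ˡ (fin m) ∞       = ≤∞-refl
min∞-≤ˡ ∞       y       = y ≤∞∞

min∞-≤ʳ : ∀ x y → min∞ x y ≤∞ y
min∞-≤ʳ (fin m) (fin n) = fin≤fin (ℕₚ.m⊓n≤n m n)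
min∞-≤ʳ (fin m) ∞       = fin m ≤∞∞
min∞-≤ʳ ∞       y       = ≤∞-refl

n<2^n : ∀ n → n < 2 ^ n
n<2^n zero    = s≤s z≤n
n<2^n (suc n) = ℕₚ.≤-trans (s≤s (n<2^n n)) (ℕₚ.+-mono-≤ (ℕₚ.m^n>0 2 n) (ℕₚ.m≤m+n (2 ^ n) 0))

2^k∣2^n : ∀ {k n} → k ≤ n → 2 ^ k ∣ 2 ^ n
2^k∣2^n {n = n} z≤n       = ℕ∣.1∣ (2 ^ n)
2^k∣2^n         (s≤s k≤n) = ℕ∣.*-monoʳ-∣ 2 (2^k∣2^n k≤n)

2^val2∣ : ∀ n f → 2 ^ val2 n f ∣ n
2^val2∣ n zero    = ℕ∣.1∣ n
2^val2∣ n (suc f) with n % 2 ≟ 0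
... | yes n%2≡0 = ℕ∣.m∣n/o⇒o*m∣n (ℕ∣.m%n≡0⇒n∣m n 2 n%2≡0) (2^val2∣ (n / 2) f)
... | no  _     = ℕ∣.1∣ n

∣⇒≤val2 : ∀ {k} n f → k ≤ f → 2 ^ k ∣ n → n ≢ 0 → k ≤ val2 n f
∣⇒≤val2 {zero}  n f       _         _   _   = z≤n
∣⇒≤val2 {suc k} n (suc f) (s≤s k≤f) 2k∣n n≢0 with n % 2 ≟ 0
... | yes n%2≡0 = s≤s (∣⇒≤val2 (n / 2) f k≤f (ℕ∣.m*n∣o⇒n∣o/m 2 (2 ^ k) 2k∣n) n/2≢0)
  where
  n/2≢0 : n / 2 ≢ 0
  n/2≢0 n/2≡0 = n≢0 (trans (m≡m%n+[m/n]*n n 2) (cong₂ (λ a b → a ℕ.+ b ℕ.* 2) n%2≡0 n/2≡0))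
... | no n%2≢0 = ⊥-elim (n%2≢0 (ℕ∣.n∣m⇒m%n≡0 n 2 (ℕ∣.m*n∣⇒m∣ 2 (2 ^ k) 2k∣n)))

≤ν₂⇒∣ : ∀ {k} x → fin k ≤∞ ν₂ x → 2 ^ k ∣ ∣ x ∣
≤ν₂⇒∣ {k} x _ with ∣ x ∣
... | zero = (2 ^ k) ℕ∣.∣0
≤ν₂⇒∣ x (fin≤fin k≤v) | suc n = ℕ∣.∣-trans (2^k∣2^n k≤v) (2^val2∣ (suc n) (suc n))

-- A nonzero x cannot be divisible by all powers of 2, since 2 ^ k ∣ x forces k < 2 ^ k ≤ ∣ x ∣;
-- the same bound shows the fuel ∣ x ∣ used by ν₂ is enough.
∣⇒≤ν₂ : ∀ c x → (∀ k → fin k ≤∞ c → 2 ^ k ∣ ∣ x ∣) → c ≤∞ ν₂ x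
∣⇒≤ν₂ c x 2^k∣x with ∣ x ∣
... | zero = c ≤∞∞
∣⇒≤ν₂ (fin j) x 2^k∣x | suc n = fin≤fin (∣⇒≤val2 (suc n) (suc n) j≤1+n 2^j∣x (λ ()))
  where
  2^j∣x = 2^k∣x j ≤∞-refl
  j≤1+n : j ≤ suc n
  j≤1+n = ℕₚ.<⇒≤ (ℕₚ.<-≤-trans (n<2^n j) (ℕ∣.∣⇒≤ 2^j∣x))
∣⇒≤ν₂ ∞ x 2^k∣x | suc n =
  ⊥-elim (ℕₚ.<⇒≱ (n<2^n (suc n)) (ℕ∣.∣⇒≤ (2^k∣x (suc n) (fin (suc n) ≤∞∞))))

ν₂-+ : ∀ {c} x y → c ≤∞ ν₂ x → c ≤∞ ν₂ y → c ≤∞ ν₂ (x ℤ.+ y)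
ν₂-+ {c} x y c≤νx c≤νy = ∣⇒≤ν₂ c (x ℤ.+ y) λ k k≤c →
  ℤ∣.∣⇒∣ᵤ {+ (2 ^ k)} {x ℤ.+ y}
    (ℤ∣.∣m∣n⇒∣m+n (ℤ∣.∣ᵤ⇒∣ {+ (2 ^ k)} {x} (≤ν₂⇒∣ x (≤∞-trans k≤c c≤νx)))
                  (ℤ∣.∣ᵤ⇒∣ {+ (2 ^ k)} {y} (≤ν₂⇒∣ y (≤∞-trans k≤c c≤νy))))

ν₂-* : ∀ {a b} x y → a ≤∞ ν₂ x → b ≤∞ ν₂ y → a +∞ b ≤∞ ν₂ (x ℤ.* y)
ν₂-* {a} {b} x y a≤νx b≤νy = ∣⇒≤ν₂ (a +∞ b) (x ℤ.* y) λ k k≤a+b →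
  subst (2 ^ k ∣_) (sym (ℤₚ.abs-* x y)) (2^k∣xy a b k≤a+b a≤νx b≤νy)
  where
  2^k∣xy : ∀ {k} a b → fin k ≤∞ a +∞ b → a ≤∞ ν₂ x → b ≤∞ ν₂ y → 2 ^ k ∣ ∣ x ∣ ℕ.* ∣ y ∣
  2^k∣xy {k} ∞ b _ a≤νx _ = ℕ∣.∣m⇒∣m*n ∣ y ∣ (≤ν₂⇒∣ x (≤∞-trans (fin k ≤∞∞) a≤νx))
  2^k∣xy {k} (fin i) ∞ _ _ b≤νy = ℕ∣.∣n⇒∣m*n ∣ x ∣ (≤ν₂⇒∣ y (≤∞-trans (fin k ≤∞∞) b≤νy))
  2^k∣xy (fin i) (fin j) (fin≤fin k≤i+j) i≤νx j≤νy =
    ℕ∣.∣-trans (2^k∣2^n k≤i+j)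
      (subst (_∣ ∣ x ∣ ℕ.* ∣ y ∣) (sym (ℕₚ.^-distribˡ-+-* 2 i j))
        (ℕ∣.*-pres-∣ (≤ν₂⇒∣ x i≤νx) (≤ν₂⇒∣ y j≤νy)))

ν₂-Σ< : ∀ {c} n f → (∀ t → c ≤∞ ν₂ (f t)) → c ≤∞ ν₂ (Σ< n f)
ν₂-Σ< {c} zero    f _    = c ≤∞∞
ν₂-Σ<     (suc n) f c≤νf = ν₂-+ (Σ< n f) (f n) (ν₂-Σ< n f c≤νf) (c≤νf n)

Σ<-cong : ∀ n {f g} → (∀ t → f t ≡ g t) → Σ< n f ≡ Σ< n g
Σ<-cong zero    f≡g = refl
Σ<-cong (suc n) f≡g = cong₂ ℤ._+_ (Σ<-cong n f≡g) (f≡g n)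

Σ<-+ : ∀ n f g → Σ< n (λ t → f t ℤ.+ g t) ≡ Σ< n f ℤ.+ Σ< n g
Σ<-+ zero    f g = refl
Σ<-+ (suc n) f g = trans (cong (ℤ._+ (f n ℤ.+ g n)) (Σ<-+ n f g))
                         (+-interchange (Σ< n f) (Σ< n g) (f n) (g n))
  where
  +-interchange : ∀ a b c d → (a ℤ.+ b) ℤ.+ (c ℤ.+ d) ≡ (a ℤ.+ c) ℤ.+ (b ℤ.+ d)
  +-interchange = solve-∀

Σ<-zero : ∀ n f → (∀ t → t < n → f t ≡ + 0) → Σ< n f ≡ + 0
Σ<-zero zero    f _   = refl
Σ<-zero (suc n) f f≡0 rewrite Σ<-zero n f (λ t t<n → f≡0 t (ℕₚ.m<n⇒m<1+n t<n))
                            | f≡0 n ℕₚ.≤-refl = refl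

Σ<-extend : ∀ {R} n f → R ≤ n → (∀ t → R ≤ t → f t ≡ + 0) → Σ< n f ≡ Σ< R f
Σ<-extend zero    f z≤n  _   = refl
Σ<-extend (suc n) f R≤1+n f≡0 with ℕₚ.m≤n⇒m<n∨m≡n R≤1+n
... | inj₂ refl    = refl
... | inj₁ (s≤s R≤n) rewrite f≡0 n R≤n = trans (ℤₚ.+-identityʳ _) (Σ<-extend n f R≤n f≡0)

Σ<-point : ∀ {r} n f → r < n → (∀ t → t ≢ r → f t ≡ + 0) → Σ< n f ≡ f r
Σ<-point {r} (suc n) f r<1+n f≡0 with r ≟ n
... | yes refl rewrite Σ<-zero n f (λ t t<r → f≡0 t (ℕₚ.<⇒≢ t<r)) = ℤₚ.+-identityˡ _
... | no r≢n rewrite Σ<-point n f (ℕₚ.≤∧≢⇒< (ℕₚ.≤-pred r<1+n) r≢n) f≡0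
                   | f≡0 n (λ n≡r → r≢n (sym n≡r)) = ℤₚ.+-identityʳ _

I-diag : ∀ r → I r r ≡ + 1
I-diag r with r ≟ r
... | yes _   = refl
... | no r≢r = ⊥-elim (r≢r refl)

I-offdiag : ∀ {r s} → r ≢ s → I r s ≡ + 0
I-offdiag {r} {s} r≢s with r ≟ s
... | yes r≡s = ⊥-elim (r≢s r≡s)
... | no  _   = refl

Σ<-I-* : ∀ {r} n (g : ℕ → ℤ) → r < n → Σ< n (λ t → I r t ℤ.* g t) ≡ g r
Σ<-I-* {r} n g r<n = begin
  Σ< n (λ t → I r t ℤ.* g t) ≡⟨ Σ<-point n (λ t → I r t ℤ.* g t) r<n
                                  (λ t t≢r → cong (ℤ._* g t) (I-offdiag (λ r≡t → t≢r (sym r≡t)))) ⟩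
  I r r ℤ.* g r             ≡⟨ cong (ℤ._* g r) (I-diag r) ⟩
  + 1 ℤ.* g r               ≡⟨ ℤₚ.*-identityˡ (g r) ⟩
  g r                       ∎
  where open ≡-Reasoning

Σ<-*-I : ∀ {s} n (g : ℕ → ℤ) → s < n → Σ< n (λ t → g t ℤ.* I t s) ≡ g s
Σ<-*-I {s} n g s<n = begin
  Σ< n (λ t → g t ℤ.* I t s) ≡⟨ Σ<-point n (λ t → g t ℤ.* I t s) s<n
                                  (λ t t≢s → trans (cong (g t ℤ.*_) (I-offdiag t≢s)) (ℤₚ.*-zeroʳ (g t))) ⟩
  g s ℤ.* I s s             ≡⟨ cong (g s ℤ.*_) (I-diag s) ⟩
  g s ℤ.* + 1               ≡⟨ ℤₚ.*-identityʳ (g s) ⟩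
  g s                       ∎
  where open ≡-Reasoning

sq-I≡B²+2B : ∀ A r s → let B = entry A -M I in
  ∃ λ n → sq A r s ℤ.- I r s ≡ Σ< n (λ t → B r t ℤ.* B t s) ℤ.+ B r s ℤ.* + 2
sq-I≡B²+2B A r s = n , (begin
    sq A r s ℤ.- I r s
  ≡⟨ cong (ℤ._- I r s) (sym (Σ<-extend n AA R≤n AA≡0)) ⟩
    Σ< n AA ℤ.- I r s
  ≡⟨ cong (ℤ._- I r s) (Σ<-cong n (λ t → split (A′ r t) (A′ t s) (I r t) (I t s))) ⟩
    Σ< n (λ t → BB t ℤ.+ (IA t ℤ.+ BI t)) ℤ.- I r s
  ≡⟨ cong (ℤ._- I r s) (trans (Σ<-+ n BB _) (cong (ℤ._+_ (Σ< n BB)) (Σ<-+ n IA BI))) ⟩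
    Σ< n BB ℤ.+ (Σ< n IA ℤ.+ Σ< n BI) ℤ.- I r s
  ≡⟨ cong (λ z → Σ< n BB ℤ.+ z ℤ.- I r s) (cong₂ ℤ._+_ (Σ<-I-* n (λ t → A′ t s) r<n) (Σ<-*-I n (B r) s<n)) ⟩
    Σ< n BB ℤ.+ (A′ r s ℤ.+ B r s) ℤ.- I r s
  ≡⟨ collect (Σ< n BB) (A′ r s) (I r s) ⟩
    Σ< n BB ℤ.+ B r s ℤ.* + 2
  ∎)
  where
  open ≡-Reasoning
  A′ = entry A
  B  = A′ -M I
  R  = rowBound A r
  n  = suc (r ℕ.+ s ℕ.+ R)

  R≤n : R ≤ n
  R≤n = ℕₚ.m≤n⇒m≤1+n (ℕₚ.m≤n+m R (r ℕ.+ s))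
  r<n : r < n
  r<n = s≤s (ℕₚ.≤-trans (ℕₚ.m≤m+n r s) (ℕₚ.m≤m+n (r ℕ.+ s) R))
  s<n : s < n
  s<n = s≤s (ℕₚ.≤-trans (ℕₚ.m≤n+m s r) (ℕₚ.m≤m+n (r ℕ.+ s) R))

  AA BB IA BI : ℕ → ℤ
  AA t = A′ r t ℤ.* A′ t s
  BB t = B r t ℤ.* B t s
  IA t = I r t ℤ.* A′ t s
  BI t = B r t ℤ.* I t s

  AA≡0 : ∀ t → R ≤ t → AA t ≡ + 0
  AA≡0 t R≤t rewrite rowFin A r t R≤t = refl

  split : ∀ a b i j → a ℤ.* b ≡ (a ℤ.- i) ℤ.* (b ℤ.- j) ℤ.+ (i ℤ.* b ℤ.+ (a ℤ.- i) ℤ.* j)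
  split = solve-∀

  collect : ∀ x a i → x ℤ.+ (a ℤ.+ (a ℤ.- i)) ℤ.- i ≡ x ℤ.+ (a ℤ.- i) ℤ.* + 2
  collect = solve-∀

lemma4p2 : (A : IntMatrix) (M : ValMatrix) →
    νM (entry A -M I) ≥M M →
    ∀ r s (m : ℕ∞) → IsMinPlus M M r s m →
    min∞ ((M +𝟏) r s) m ≤∞ νM (sq A -M I) r s
lemma4p2 A M M≤νB r s m (_ , m≤M+M) with sq-I≡B²+2B A r s
... | n , A²-I≡B²+2B =
  subst (bound ≤∞_) (cong ν₂ (sym A²-I≡B²+2B)) (ν₂-+ (Σ< n BB) (B r s ℤ.* + 2) B²-bound 2B-bound)
  where
  B = entry A -M I
  bound = min∞ ((M +𝟏) r s) m

  BB : ℕ → ℤ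
  BB t = B r t ℤ.* B t s

  B²-bound : bound ≤∞ ν₂ (Σ< n BB)
  B²-bound = ν₂-Σ< n BB λ t →
    ≤∞-trans (min∞-≤ʳ _ m) (≤∞-trans (m≤M+M t) (ν₂-* (B r t) (B t s) (M≤νB r t) (M≤νB t s)))

  2B-bound : bound ≤∞ ν₂ (B r s ℤ.* + 2)
  2B-bound = ≤∞-trans (min∞-≤ˡ _ m) (ν₂-* (B r s) (+ 2) (M≤νB r s) ≤∞-refl)
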